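{- Let $S,T\in\{0,1,2\}^*$ and $x,y,G_x$ as in the context, and let $p$ be a path from $x$ to $y$ in $G_x$. If $x[i_s..j_s]=\mathrm{Sync}_L$ is one of the left synchronizer gadgets of $x$ not contained in $y$ (i.e. one of the two copies of $\mathrm{Sync}_L$ inside some block $E_L(S[\ell])$), then $p$ visits a vertex $x[j_s+1..k]$ for some integer $k$. Symmetrically, if $x[i_s..j_s]=\mathrm{Sync}_R$ is one of the right synchronizer gadgets of $x$ not contained in $y$ (one of the two copies of $\mathrm{Sync}_R$ inside some block $E_R(T[r])$), then $p$ visits a vertex $x[k..i_s-1]$ for some integer $k$.
   Context: Alphabet $\{0,1\}$, $\overline{0}=1$, $\overline{1}=0$; $\overline{X}$ symbolwise, $\overleftarrow{X}=\overline{X[|X|]}\cdots\overline{X[1]}$. Gadgets: $I_L(0)=(010^3)^{55}$, $I_L(1)=(010^5)^{54}$, $I_L(2)=(010^7)^{53}$, $P_L=(010^9)^{144}$, $\mathrm{Sync}_L=01$, $I_R(\alpha)=\overleftarrow{I_L(\alpha)}$, $P_R=\overleftarrow{P_L}$, $\mathrm{Sync}_R=\overline{010}$; $E_L(\alpha)=P_L\mathrm{Sync}_LI_L(\alpha)\mathrm{Sync}_L$, $E_R(\alpha)=\mathrm{Sync}_RI_R(\alpha)\mathrm{Sync}_RP_R$; $y=P_L\,\mathrm{Sync}_L\,01\,11\overline{11}\,\overline{10}\,\mathrm{Sync}_R\,P_R$, $x=E_L(S[1])\cdots E_L(S[|S|])\,y\,E_R(T[|T|])\cdots E_R(T[1])$.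 $G_x$: vertices are substrings $x[i..j]$ (identified by positions); edges from $x[i..j]$ to $x[i+\ell..j]$ and to $x[i..j-\ell]$ whenever $1\le\ell\le\lfloor(j-i+1)/2\rfloor$ and $x[i..i+\ell-1]=\overleftarrow{x[j-\ell+1..j]}$. A path from $x$ to $y$ is a path from $x[1..|x|]$ to the occurrence of $y$ in $x$ between the $E_L$ blocks and the $E_R$ blocks. -}

module Defs where

open import Data.Bool using (Bool; true; false; not)
open import Data.Nat using (ℕ; zero; suc; _+_; _∸_; _≤_)
open import Data.Nat.DivMod using (_/_)
open import Data.Fin using (Fin; zero; suc; toℕ)
open import Data.List using (List; []; _∷_; _++_; map; concat; reverse; take; drop; length; lookup; replicate)
open import Data.List.Membership.Propositional using (_∈_)
open import Data.Product using (_×_; _,_; Σ)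
open import Data.Sum using (_⊎_)
open import Relation.Binary.PropositionalEquality using (_≡_)

-- Binary words; the symbol 0 is `false`, the symbol 1 is `true`.
Word : Set
Word = List Bool

o i : Bool
o = false
i = true

bar : Word → Word
bar = map not

revbar : Word → Word
revbar X = reverse (bar X)

pow : ℕ → Word → Word
pow n w = concat (replicate n w)

zeros : ℕ → Word
zeros n = replicate n o

blk : ℕ → Word
blk m = o ∷ i ∷ zeros m

IL : Fin 3 → Word
IL zero = pow 55 (blk 3)
IL (suc zero) = pow 54 (blk 5)
IL (suc (suc zero)) = pow 53 (blk 7)

PL : Word
PL = pow 144 (blk 9)

SyncL : Word
SyncL = o ∷ i ∷ []

IR : Fin 3 → Word
IR α = revbar (IL α)

PR : Word
PR = revbar PL

SyncR : Word
SyncR = bar (o ∷ i ∷ o ∷ [])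

EL : Fin 3 → Word
EL α = PL ++ SyncL ++ IL α ++ SyncL

ER : Fin 3 → Word
ER α = SyncR ++ IR α ++ SyncR ++ PR

yw : Word
yw = PL ++ SyncL ++ (o ∷ i ∷ []) ++ (i ∷ i ∷ []) ++ bar (i ∷ i ∷ [])
        ++ bar (i ∷ o ∷ []) ++ SyncR ++ PR

leftPart : List (Fin 3) → Word
leftPart S = concat (map EL S)

rightPart : List (Fin 3) → Word
rightPart T = concat (map ER (reverse T))

xw : List (Fin 3) → List (Fin 3) → Word
xw S T = leftPart S ++ yw ++ rightPart T

-- Vertices of G_x: substrings x[i..j] identified by 1-indexed positions (i , j)
V : Set
V = ℕ × ℕ

-- x[a..b] (1-indexed, inclusive)
sub : Word → ℕ → ℕ → Word
sub w a b = take (suc b ∸ a) (drop (a ∸ 1) w)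

data Edge (w : Word) : V → V → Set where
  cutL : ∀ {a b ℓ} → 1 ≤ ℓ → ℓ ≤ (suc b ∸ a) / 2 →
         sub w a (a + ℓ ∸ 1) ≡ revbar (sub w (suc b ∸ ℓ) b) →
         Edge w (a , b) (a + ℓ , b)
  cutR : ∀ {a b ℓ} → 1 ≤ ℓ → ℓ ≤ (suc b ∸ a) / 2 →
         sub w a (a + ℓ ∸ 1) ≡ revbar (sub w (suc b ∸ ℓ) b) →
         Edge w (a , b) (a , b ∸ ℓ)

data Path (w : Word) : V → V → Set where
  stop : ∀ {v} → Path w v v
  step : ∀ {u v t} → Edge w u v → Path w v t → Path w u t

vertices : ∀ {w u t} → Path w u t → List V
vertices (stop {v}) = v ∷ []
vertices (step {u} e p) = u ∷ vertices p

Visits : ∀ {w u t} → Path w u t → V → Set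
Visits p v = v ∈ vertices p

xVertex : List (Fin 3) → List (Fin 3) → V
xVertex S T = (1 , length (xw S T))

yVertex : List (Fin 3) → List (Fin 3) → V
yVertex S T = (suc (length (leftPart S)) , length (leftPart S) + length yw)

-- (i_s , j_s) is one of the two copies of Sync_L inside block E_L(S[ℓ])
LeftSync : List (Fin 3) → ℕ → ℕ → Set
LeftSync S is js = Σ (Fin (length S)) λ ℓ →
  let off = length (leftPart (take (toℕ ℓ) S)) + length PL in
  (is ≡ off + 1 ⊎ is ≡ off + length SyncL + length (IL (lookup S ℓ)) + 1)
  × js ≡ is + 1

-- (i_s , j_s) is one of the two copies of Sync_R inside block E_R(T[r])
RightSync : List (Fin 3) → List (Fin 3) → ℕ → ℕ → Set
RightSync S T is js = Σ (Fin (length T)) λ r →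
  let off = length (leftPart S) + length yw + length (rightPart (drop (suc (toℕ r)) T)) in
  (is ≡ off + 1 ⊎ is ≡ off + length SyncR + length (IR (lookup T r)) + 1)
  × js ≡ is + 2

-- Along a path from x to y every vertex starts with 0 and ends with 1 (true at y, and an edge removes a prefix
-- and a suffix that are reverse complements of each other), and no vertex opens with 00 and closes with 11.
-- Suppose a left cut x[a..b] → x[a+ℓ..b] jumps over j+1, where x[j] is the 1 of a Sync_L. Since x[j+2] = 1
-- it cannot land on j+2, so the removed prefix contains the 101 at j; its mirror image is a 010 in the
-- removed suffix. But 010 occurs in x only up to the Sync_L of y, while b reaches the end of y; so the suffix
-- also covers the 00 of y, whose mirror image is a 11 among the E_L blocks, which contain none.
-- Symmetrically a right cut jumping over the position before a Sync_R would mirror the 0110 around it to a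
-- 1001, which x does not contain, or make the vertex open with 00 and close with 11.

module Submission where

open import Defs
open import Data.Bool using (Bool; true; false; not; _∧_; _xor_)
open import Data.Bool.Properties using (not-involutive; xor-same)
open import Data.Empty using (⊥; ⊥-elim)
open import Data.Fin using (Fin; zero; suc; toℕ)
open import Data.List using (List; []; _∷_; _++_; map; concat; reverse; take; drop; length; lookup)
open import Data.List.Membership.Propositional using (_∈_)
open import Data.List.Properties
  using (length-++; length-map; length-reverse; length-take; length-drop; unfold-reverse; ++-assoc; ++-identityʳ; map-++; concat-++)
open import Data.List.Relation.Unary.Any using (here; there)
open import Data.Nat using (ℕ; zero; suc; _+_; _∸_; _≤_; _<_; z≤n; s≤s; _≤?_; _≟_)
open import Data.Nat.DivMod using (_/_; m/n≤m)
open import Data.Nat.Properties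
open import Data.Nat.Tactic.RingSolver using (solve-∀)
open import Data.Product using (_×_; _,_; ∃; proj₁; proj₂)
open import Data.Sum using (_⊎_; inj₁; inj₂)
open import Data.Unit using (⊤; tt)
open import Function using (_∘_)
open import Relation.Nullary using (yes; no; contradiction)
open import Relation.Binary.PropositionalEquality

-- Letters, mirrors and occurrences

-- Letter k (0-indexed) of a word; a junk `false` past its end.
at : Word → ℕ → Bool
at []      _       = false
at (c ∷ w) zero    = c
at (c ∷ w) (suc k) = at w k

-- The 1-indexed letter x[q] of the paper; w ‼ suc k reduces to at w k.
_‼_ : Word → ℕ → Bool
w ‼ q = at w (q ∸ 1)

≡not-sym : ∀ {x y} → x ≡ not y → y ≡ not x
≡not-sym {y = y} e = trans (sym (not-involutive y)) (cong not (sym e))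

at-++ˡ : ∀ u v {k} → k < length u → at (u ++ v) k ≡ at u k
at-++ˡ (c ∷ u) v {zero}  _         = refl
at-++ˡ (c ∷ u) v {suc k} (s≤s k<) = at-++ˡ u v k<

at-++ʳ : ∀ u v k → at (u ++ v) (length u + k) ≡ at v k
at-++ʳ []      v k = refl
at-++ʳ (c ∷ u) v k = at-++ʳ u v k

at-drop : ∀ n w k → at (drop n w) k ≡ at w (n + k)
at-drop zero    w       k = refl
at-drop (suc n) []      k = refl
at-drop (suc n) (c ∷ w) k = at-drop n w k

at-take : ∀ n w {k} → k < n → at (take n w) k ≡ at w k
at-take (suc n) []      _          = refl
at-take (suc n) (c ∷ w) {zero}  _  = refl
at-take (suc n) (c ∷ w) {suc k} (s≤s k<n) = at-take n w k<n

at-map-not : ∀ u {k} → k < length u → at (map not u) k ≡ not (at u k)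
at-map-not (c ∷ u) {zero}  _         = refl
at-map-not (c ∷ u) {suc k} (s≤s k<) = at-map-not u k<

at-reverse : ∀ u t s → t + suc s ≡ length u → at (reverse u) t ≡ at u s
at-reverse []      t s    e = ⊥-elim (m+1+n≢0 t e)
at-reverse (c ∷ u) t zero e rewrite unfold-reverse c u = begin
  at (reverse u ++ c ∷ []) t                         ≡⟨ cong (at (reverse u ++ c ∷ [])) t≡ ⟩
  at (reverse u ++ c ∷ []) (length (reverse u) + 0) ≡⟨ at-++ʳ (reverse u) (c ∷ []) 0 ⟩
  c                                                  ∎
  where
  open ≡-Reasoning
  t≡ : t ≡ length (reverse u) + 0
  t≡ = trans (suc-injective (trans (+-comm 1 t) e)) (sym (trans (+-identityʳ _) (length-reverse u)))
at-reverse (c ∷ u) t (suc s) e rewrite unfold-reverse c u =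
  trans (at-++ˡ (reverse u) (c ∷ []) t<) (at-reverse u t s e′)
  where
  e′ : t + suc s ≡ length u
  e′ = suc-injective (trans (sym (+-suc t (suc s))) e)
  t< : t < length (reverse u)
  t< = subst (t <_) (sym (length-reverse u)) (subst (t <_) e′ (m<m+n t (s≤s z≤n)))

at-true⇒< : ∀ w {k} → at w k ≡ true → k < length w
at-true⇒< (c ∷ w) {zero}  _ = s≤s z≤n
at-true⇒< (c ∷ w) {suc k} e = s≤s (at-true⇒< w e)

-- x[a + t] = not x[b − t] for t < ℓ, with b − t written as s to avoid truncated subtraction.
Mirror : Word → ℕ → ℕ → ℕ → Set
Mirror w a b ℓ = ∀ t s → t < ℓ → t + s ≡ b → w ‼ (a + t) ≡ not (w ‼ s)

≤⇒∃+ : ∀ {m n} → m ≤ n → ∃ λ k → k + m ≡ n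
≤⇒∃+ {m} {n} m≤n = n ∸ m , m∸n+n≡m m≤n

mirror-of-take-drop : ∀ w a₀ c ℓ → c + ℓ ≤ length w →
  take ℓ (drop a₀ w) ≡ revbar (take ℓ (drop c w)) → Mirror w (suc a₀) (c + ℓ) ℓ
mirror-of-take-drop w a₀ c ℓ c+ℓ≤ eq t s t<ℓ t+s≡ with s′ , refl ← ≤⇒∃+ t<ℓ = begin
  at w (a₀ + t)                         ≡⟨ sym (at-drop a₀ w t) ⟩
  at (drop a₀ w) t                      ≡⟨ sym (at-take (s′ + suc t) (drop a₀ w) t<ℓ) ⟩
  at (take (s′ + suc t) (drop a₀ w)) t  ≡⟨ cong (λ u → at u t) eq ⟩
  at (reverse (map not W)) t            ≡⟨ at-reverse (map not W) t s′ (trans (+-comm t (suc s′)) (sym |notW|)) ⟩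
  at (map not W) s′                     ≡⟨ at-map-not W s′<|W| ⟩
  not (at W s′)                         ≡⟨ cong not (at-take (s′ + suc t) (drop c w) s′<ℓ) ⟩
  not (at (drop c w) s′)                ≡⟨ cong not (at-drop c w s′) ⟩
  not (at w (c + s′))                   ≡⟨ cong (λ q → not (w ‼ q)) (sym s≡) ⟩
  not (w ‼ s)                           ∎
  where
  open ≡-Reasoning
  W = take (s′ + suc t) (drop c w)
  s≡ : s ≡ suc (c + s′)
  s≡ = +-cancelˡ-≡ t s (suc (c + s′)) (trans t+s≡ (shuffle c s′ t))
    where
    shuffle : ∀ c s′ t → c + (s′ + suc t) ≡ t + suc (c + s′)
    shuffle = solve-∀
  |W| : length W ≡ s′ + suc t
  |W| = trans (length-take _ (drop c w))
          (m≤n⇒m⊓n≡m (subst (s′ + suc t ≤_) (sym (length-drop c w)) (m+n≤o⇒m≤o∸n (s′ + suc t) (subst (_≤ length w) (+-comm c _) c+ℓ≤))))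
  |notW| : length (map not W) ≡ suc s′ + t
  |notW| = trans (length-map not W) (trans |W| (+-suc s′ t))
  s′<ℓ : s′ < s′ + suc t
  s′<ℓ = m<m+n s′ (s≤s z≤n)
  s′<|W| : s′ < length W
  s′<|W| = subst (s′ <_) (sym |W|) s′<ℓ

record Cut (w : Word) (a b ℓ : ℕ) : Set where
  field
    positive : 1 ≤ ℓ
    ℓ≤b      : ℓ ≤ b
    mirror   : Mirror w a b ℓ

cut-of-edge : ∀ {w a b ℓ} → 1 ≤ a → b ≤ length w → 1 ≤ ℓ → ℓ ≤ (suc b ∸ a) / 2 →
  sub w a (a + ℓ ∸ 1) ≡ revbar (sub w (suc b ∸ ℓ) b) → Cut w a b ℓ
cut-of-edge {w} {suc a₀} {b} {ℓ} _ b≤ 1≤ℓ ℓ≤half eq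
  with c , refl ← ≤⇒∃+ (≤-trans ℓ≤half (≤-trans (m/n≤m (b ∸ a₀) 2) (m∸n≤m b a₀))) =
  record { positive = 1≤ℓ ; ℓ≤b = m≤n+m ℓ c ; mirror = mirror-of-take-drop w a₀ c ℓ b≤ eq′ }
  where
  eq′ : take ℓ (drop a₀ w) ≡ revbar (take ℓ (drop c w))
  eq′ = trans (cong (λ n → take n (drop a₀ w)) (sym (m+n∸m≡n a₀ ℓ))) (trans eq (cong revbar suffix))
    where
    suffix : sub w (suc (c + ℓ) ∸ ℓ) (c + ℓ) ≡ take ℓ (drop c w)
    suffix rewrite m+n∸n≡m (suc c) ℓ | m+n∸m≡n c ℓ = refl

OccursAt : Word → Word → ℕ → Set
OccursAt []      w q = ⊤
OccursAt (c ∷ P) w q = w ‼ q ≡ c × OccursAt P w (suc q)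

occurs-++ : ∀ P {Q w q} → OccursAt P w q → OccursAt Q w (length P + q) → OccursAt (P ++ Q) w q
occurs-++ []      _         occ = occ
occurs-++ (c ∷ P) {Q} {w} {q} (e , occP) occQ =
  e , occurs-++ P occP (subst (OccursAt Q w) (sym (+-suc (length P) q)) occQ)

occurs-++ʳ : ∀ P u v k → OccursAt P v (suc k) → OccursAt P (u ++ v) (suc (length u + k))
occurs-++ʳ []      u v k _         = tt
occurs-++ʳ (c ∷ P) u v k (e , occ) =
  trans (at-++ʳ u v k) e , subst (OccursAt P (u ++ v) ∘ suc) (+-suc (length u) k) (occurs-++ʳ P u v (suc k) occ)

occurs-++ʳ⁻ : ∀ P u v k → OccursAt P (u ++ v) (suc (length u + k)) → OccursAt P v (suc k)
occurs-++ʳ⁻ []      u v k _         = tt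
occurs-++ʳ⁻ (c ∷ P) u v k (e , occ) =
  trans (sym (at-++ʳ u v k)) e , occurs-++ʳ⁻ P u v (suc k) (subst (OccursAt P (u ++ v) ∘ suc) (sym (+-suc (length u) k)) occ)

occurs-++ˡ⁻ : ∀ P u v k → k + length P ≤ length u → OccursAt P (u ++ v) (suc k) → OccursAt P u (suc k)
occurs-++ˡ⁻ []      u v k _     _         = tt
occurs-++ˡ⁻ (c ∷ P) u v k fits (e , occ) =
  trans (sym (at-++ˡ u v (≤-trans (s≤s (m≤m+n k (length P))) (subst (_≤ length u) (+-suc k (length P)) fits)))) e ,
  occurs-++ˡ⁻ P u v (suc k) (subst (_≤ length u) (+-suc k (length P)) fits) occ

revbar-∷ : ∀ c P → revbar (c ∷ P) ≡ revbar P ++ not c ∷ []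
revbar-∷ c P = unfold-reverse (not c) (map not P)

length-revbar : ∀ P → length (revbar P) ≡ length P
length-revbar P = trans (length-reverse (map not P)) (length-map not P)

mirror-occursʳ : ∀ {w a b ℓ} → Mirror w a b ℓ → ∀ P t s → t + length P ≤ ℓ → t + length P + s ≡ suc b →
  OccursAt P w (a + t) → OccursAt (revbar P) w s
mirror-occursʳ m []      t s _    _  _         = tt
mirror-occursʳ {w} {a} {b} {ℓ} m (c ∷ P) t s fits eq (e , occ) =
  subst (λ R → OccursAt R w s) (sym (revbar-∷ c P)) (occurs-++ (revbar P) rest (last , tt))
  where
  rest : OccursAt (revbar P) w s
  rest = mirror-occursʳ m P (suc t) s (subst (_≤ ℓ) (+-suc t (length P)) fits)
           (trans (cong (_+ s) (sym (+-suc t (length P)))) eq)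
           (subst (OccursAt P w) (sym (+-suc a t)) occ)
  last : w ‼ (length (revbar P) + s) ≡ not c
  last = begin
    w ‼ (length (revbar P) + s)  ≡⟨ cong (λ n → w ‼ (n + s)) (length-revbar P) ⟩
    w ‼ (length P + s)           ≡⟨ ≡not-sym (m t (length P + s) (≤-trans (m<m+n t (s≤s z≤n)) fits) t+Ps≡b) ⟩
    not (w ‼ (a + t))            ≡⟨ cong not e ⟩
    not c                        ∎
    where
    open ≡-Reasoning
    t+Ps≡b : t + (length P + s) ≡ b
    t+Ps≡b = suc-injective (trans (shuffle t (length P) s) eq)
      where
      shuffle : ∀ t p s → suc (t + (p + s)) ≡ t + suc p + s
      shuffle = solve-∀

mirror-occursˡ : ∀ {w a b ℓ} → Mirror w a b ℓ → ∀ P t s → t + length P ≤ ℓ → t + length P + s ≡ suc b →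
  OccursAt P w s → OccursAt (revbar P) w (a + t)
mirror-occursˡ m []      t s _    _  _         = tt
mirror-occursˡ {w} {a} {b} {ℓ} m (c ∷ P) t s fits eq (e , occ) =
  subst (λ R → OccursAt R w (a + t)) (sym (revbar-∷ c P)) (occurs-++ (revbar P) rest (last , tt))
  where
  rest : OccursAt (revbar P) w (a + t)
  rest = mirror-occursˡ m P t (suc s) (≤-trans (+-monoʳ-≤ t (n≤1+n (length P))) fits)
           (trans (shuffle t (length P) s) eq) occ
    where
    shuffle : ∀ t p s → t + p + suc s ≡ t + suc p + s
    shuffle = solve-∀
  last : w ‼ (length (revbar P) + (a + t)) ≡ not c
  last = begin
    w ‼ (length (revbar P) + (a + t)) ≡⟨ cong (w ‼_) (trans (shuffle (length (revbar P)) a t) (cong (λ n → a + (t + n)) (length-revbar P))) ⟩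
    w ‼ (a + (t + length P))          ≡⟨ m (t + length P) s (subst (_≤ ℓ) (+-suc t (length P)) fits) tPs≡b ⟩
    not (w ‼ s)                       ≡⟨ cong not e ⟩
    not c                             ∎
    where
    open ≡-Reasoning
    shuffle : ∀ p a t → p + (a + t) ≡ a + (t + p)
    shuffle = solve-∀
    tPs≡b : t + length P + s ≡ b
    tPs≡b = suc-injective (trans (sym (shuffle′ t (length P) s)) eq)
      where
      shuffle′ : ∀ t p s → t + suc p + s ≡ suc (t + p + s)
      shuffle′ = solve-∀

-- Paths in G_w

p00 p11 p010 p101 p0110 p1001 : Word
p00   = o ∷ o ∷ []
p11   = i ∷ i ∷ []
p010  = o ∷ i ∷ o ∷ []
p101  = i ∷ o ∷ i ∷ []
p0110 = o ∷ i ∷ i ∷ o ∷ []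
p1001 = i ∷ o ∷ o ∷ i ∷ []

module Paths (w : Word) where

  -- What rules out the shortest cut in no-cut-before-0110.
  NoOpen00Close11 : ℕ → ℕ → Set
  NoOpen00Close11 a b = w ‼ a ≡ false → w ‼ suc a ≡ false → w ‼ b ≡ true → w ‼ (b ∸ 1) ≡ true → ⊥

  Admissible : V → Set
  Admissible (a , b) = 1 ≤ a × b ≤ length w × NoOpen00Close11 a b

  Starts0Ends1 : V → Set
  Starts0Ends1 (a , b) = w ‼ a ≡ false × w ‼ b ≡ true

  admissible-cut : ∀ {a b ℓ} → Admissible (a , b) → 1 ≤ ℓ → ℓ ≤ (suc b ∸ a) / 2 →
    sub w a (a + ℓ ∸ 1) ≡ revbar (sub w (suc b ∸ ℓ) b) → Cut w a b ℓ
  admissible-cut (1≤a , b≤ , _) = cut-of-edge 1≤a b≤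

  cut-ends : ∀ {a b ℓ} → Cut w a b ℓ → w ‼ a ≡ not (w ‼ b)
  cut-ends {a} {b} c = subst (λ n → w ‼ n ≡ not (w ‼ b)) (+-identityʳ a) (Cut.mirror c 0 b (Cut.positive c) refl)

  cut-second : ∀ {a b ℓ} → Cut w a b ℓ → 2 ≤ ℓ → w ‼ suc a ≡ not (w ‼ (b ∸ 1))
  cut-second {a} {b} c 2≤ℓ = subst (λ n → w ‼ n ≡ not (w ‼ (b ∸ 1))) (+-comm a 1)
    (Cut.mirror c 1 (b ∸ 1) 2≤ℓ (m+[n∸m]≡n (≤-trans (Cut.positive c) (Cut.ℓ≤b c))))

  second-after-cutL : ∀ {a b ℓ} → Cut w a b ℓ → w ‼ (a + ℓ) ≡ false → w ‼ (b ∸ 1) ≡ true → w ‼ suc a ≡ false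
  second-after-cutL {ℓ = zero} c _ _ with () ← Cut.positive c
  second-after-cutL {a} {ℓ = suc zero} c x₀ _ = subst (λ n → w ‼ n ≡ false) (+-comm a 1) x₀
  second-after-cutL {ℓ = suc (suc _)} c _ y₁ = trans (cut-second c (s≤s (s≤s z≤n))) (cong not y₁)

  penultimate-after-cutR : ∀ {a b ℓ} → Cut w a b ℓ → w ‼ suc a ≡ false → w ‼ (b ∸ ℓ) ≡ true → w ‼ (b ∸ 1) ≡ true
  penultimate-after-cutR {ℓ = zero} c _ _ with () ← Cut.positive c
  penultimate-after-cutR {ℓ = suc zero} c _ y₀ = y₀
  penultimate-after-cutR {ℓ = suc (suc _)} c x₁ _ = trans (≡not-sym (cut-second c (s≤s (s≤s z≤n)))) (cong not x₁)

  admissible-step : ∀ {u v} → Admissible u → Edge w u v → Admissible v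
  admissible-step {a , b} adm@(1≤a , b≤ , G) (cutL {ℓ = ℓ} 1≤ℓ ℓ≤ eq) =
    ≤-trans 1≤a (m≤m+n a ℓ) , b≤ ,
    λ x₀ x₁ y₀ y₁ → G (trans (cut-ends c) (cong not y₀)) (second-after-cutL c x₀ y₁) y₀ y₁
    where c = admissible-cut adm 1≤ℓ ℓ≤ eq
  admissible-step {a , b} adm@(1≤a , b≤ , G) (cutR {ℓ = ℓ} 1≤ℓ ℓ≤ eq) =
    1≤a , ≤-trans (m∸n≤m b ℓ) b≤ ,
    λ x₀ x₁ y₀ y₁ → G x₀ x₁ (trans (≡not-sym (cut-ends c)) (cong not x₀)) (penultimate-after-cutR c x₁ y₀)
    where c = admissible-cut adm 1≤ℓ ℓ≤ eq

  starts0ends1-backward : ∀ {u t} → Path w u t → Admissible u → Starts0Ends1 t → Starts0Ends1 u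
  starts0ends1-backward stop _ st = st
  starts0ends1-backward (step e@(cutL 1≤ℓ ℓ≤ eq) p) adm st
    with _ , y ← starts0ends1-backward p (admissible-step adm e) st =
    trans (cut-ends (admissible-cut adm 1≤ℓ ℓ≤ eq)) (cong not y) , y
  starts0ends1-backward (step e@(cutR 1≤ℓ ℓ≤ eq) p) adm st
    with x , _ ← starts0ends1-backward p (admissible-step adm e) st =
    x , trans (≡not-sym (cut-ends (admissible-cut adm 1≤ℓ ℓ≤ eq))) (cong not x)

  path-shrinks : ∀ {u t} → Path w u t → proj₁ u ≤ proj₁ t × proj₂ t ≤ proj₂ u
  path-shrinks stop = ≤-refl , ≤-refl
  path-shrinks (step (cutL {a = a} {ℓ = ℓ} _ _ _) p) with a≤ , b≤ ← path-shrinks p = ≤-trans (m≤m+n a ℓ) a≤ , b≤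
  path-shrinks (step (cutR {b = b} {ℓ = ℓ} _ _ _) p) with a≤ , b≤ ← path-shrinks p = a≤ , ≤-trans b≤ (m∸n≤m b ℓ)

  -- A cut whose prefix covers the 101 at J would carry it to a 010 at q and the 00 at Z to a 11 at a + t;
  -- since 010 occurs only up to M, the latter lands strictly before J, where 11 does not occur.
  no-cut-across-101 : ∀ {a b ℓ J M Z} → b ≤ length w → Cut w a b ℓ →
    OccursAt p101 w J → OccursAt p00 w Z → M + 2 ≤ Z →
    (∀ q → q + 2 ≤ length w → OccursAt p010 w q → q ≤ M) →
    (∀ q → 1 ≤ q → suc q ≤ J → OccursAt p11 w q → ⊥) →
    1 ≤ a → a ≤ J → 3 + J ≤ a + ℓ → suc Z ≤ b → ⊥
  no-cut-across-101 {a} {b} {ℓ} {J} {M} {Z} b≤ c sync zeros M+2≤Z 010≤M no11 1≤a a≤J J+3≤ Z<b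
    with u , refl ← m≤n⇒∃[o]m+o≡n a≤J
    with t , refl ← ≤⇒∃+ Z<b =
    no11 (a + t) (≤-trans 1≤a (m≤m+n a t)) (subst (_≤ a + u) (+-suc a t) (+-monoʳ-≤ a t<u)) occ11
    where
    u+3≤ℓ : u + 3 ≤ ℓ
    u+3≤ℓ = +-cancelˡ-≤ a (u + 3) ℓ (subst (_≤ a + ℓ) (shuffle a u) J+3≤)
      where
      shuffle : ∀ a u → 3 + (a + u) ≡ a + (u + 3)
      shuffle = solve-∀
    q : ℕ
    q = t + suc Z ∸ (u + 2)
    q+u+2≡b : q + (u + 2) ≡ t + suc Z
    q+u+2≡b = m∸n+n≡m (≤-trans (+-monoʳ-≤ u (n≤1+n 2)) (≤-trans u+3≤ℓ (Cut.ℓ≤b c)))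
    occ010 : OccursAt p010 w q
    occ010 = mirror-occursʳ {w} {a} (Cut.mirror c) p101 u q u+3≤ℓ (trans (shuffle u q) (cong suc q+u+2≡b)) sync
      where
      shuffle : ∀ u q → u + 3 + q ≡ suc (q + (u + 2))
      shuffle = solve-∀
    q≤M : q ≤ M
    q≤M = 010≤M q (≤-trans (+-monoʳ-≤ q (m≤n+m 2 u)) (subst (_≤ length w) (sym q+u+2≡b) b≤)) occ010
    t<u : suc t ≤ u
    t<u = +-cancelˡ-≤ Z (suc t) u (begin
      Z + suc t      ≡⟨ +-comm Z (suc t) ⟩
      suc t + Z      ≡⟨ sym (+-suc t Z) ⟩
      t + suc Z      ≡⟨ sym q+u+2≡b ⟩
      q + (u + 2)    ≤⟨ +-monoˡ-≤ (u + 2) q≤M ⟩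
      M + (u + 2)    ≡⟨ shuffle M u ⟩
      u + (M + 2)    ≤⟨ +-monoʳ-≤ u M+2≤Z ⟩
      u + Z          ≡⟨ +-comm u Z ⟩
      Z + u          ∎)
      where
      open ≤-Reasoning
      shuffle : ∀ M u → M + (u + 2) ≡ u + (M + 2)
      shuffle = solve-∀
    occ11 : OccursAt p11 w (a + t)
    occ11 = mirror-occursˡ {w} {a} (Cut.mirror c) p00 t Z
      (≤-trans (+-monoˡ-≤ 2 (<⇒≤ t<u)) (≤-trans (+-monoʳ-≤ u (n≤1+n 2)) u+3≤ℓ))
      (shuffle t Z) zeros
      where
      shuffle : ∀ t Z → t + 2 + Z ≡ suc (t + suc Z)
      shuffle = solve-∀

  -- A cut whose suffix reaches into the 0110 at D from the right carries it to a 1001 at a + t, or, when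
  -- b = D + 2, carries its 011 to a 001 at a, so that x[a..b] opens with 00 and closes with 11.
  no-cut-before-0110 : ∀ {a b ℓ D} → Admissible (a , b) → Cut w a b ℓ → OccursAt p0110 w D →
    (∀ q → 1 ≤ q → OccursAt p1001 w q → ⊥) → suc (suc D) ≤ b → b < D + ℓ → ⊥
  no-cut-before-0110 {a} {b} {ℓ} {D} (1≤a , _ , G) c (e₀ , e₁ , e₂ , e₃ , _) no1001 D+2≤b b<
    with ≤⇒∃+ D+2≤b
  ... | zero , refl =
    G (subst (λ n → w ‼ n ≡ false) (+-identityʳ a) (proj₁ occ001))
      (subst (λ n → w ‼ suc n ≡ false) (+-identityʳ a) (proj₁ (proj₂ occ001))) e₂ e₁
    where
    3≤ℓ : 3 ≤ ℓ
    3≤ℓ = +-cancelˡ-≤ D 3 ℓ (subst (_≤ D + ℓ) (+-comm 3 D) b<)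
    occ001 : OccursAt (o ∷ o ∷ i ∷ []) w (a + 0)
    occ001 = mirror-occursˡ {w} {a} (Cut.mirror c) (o ∷ i ∷ i ∷ []) 0 D 3≤ℓ refl (e₀ , e₁ , e₂ , tt)
  ... | suc t , refl = no1001 (a + t) (≤-trans 1≤a (m≤m+n a t))
    (mirror-occursˡ {w} {a} (Cut.mirror c) p0110 t D t+4≤ℓ (shuffle t D) (e₀ , e₁ , e₂ , e₃ , tt))
    where
    shuffle : ∀ t D → t + 4 + D ≡ suc (suc t + suc (suc D))
    shuffle = solve-∀
    t+4≤ℓ : t + 4 ≤ ℓ
    t+4≤ℓ = +-cancelˡ-≤ D (t + 4) ℓ (subst (_≤ D + ℓ) (shuffle′ t D) b<)
      where
      shuffle′ : ∀ t D → suc (suc t + suc (suc D)) ≡ D + (t + 4)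
      shuffle′ = solve-∀

  -- Every vertex of p starts with 0, so no left cut lands on the 1 at J + 2, and none jumps over it.
  module LeftSynchroniser
    (A B J M Z : ℕ) (J≤A : J ≤ A) (M+2≤Z : M + 2 ≤ Z) (Z<B : Z < B)
    (target : Starts0Ends1 (suc A , B))
    (sync : OccursAt p101 w J) (zeros : OccursAt p00 w Z)
    (010≤M : ∀ q → q + 2 ≤ length w → OccursAt p010 w q → q ≤ M)
    (no11 : ∀ q → 1 ≤ q → suc q ≤ A → OccursAt p11 w q → ⊥)
    where

    visits : ∀ {a b} (p : Path w (a , b) (suc A , B)) → Admissible (a , b) → a ≤ suc J →
      ∃ λ k → (suc J , k) ∈ vertices p
    visits stop _ a≤ = B , here (cong (λ n → suc n , B) (≤-antisym J≤A (≤-pred a≤)))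
    visits {a} {b} (step e@(cutL {ℓ = ℓ} 1≤ℓ ℓ≤ eq) p) adm a≤ with a ≟ suc J
    ... | yes refl = b , here refl
    ... | no a≢ with a + ℓ ≤? suc J
    ...   | yes a+ℓ≤ = let k , v = visits p (admissible-step adm e) a+ℓ≤ in k , there v
    ...   | no a+ℓ≰ with a + ℓ ≟ suc (suc J)
    ...     | yes a+ℓ≡ = contradiction (trans (sym (proj₁ (proj₂ (proj₂ sync)))) (subst (λ n → w ‼ n ≡ false) a+ℓ≡ first)) λ ()
      where
      first : w ‼ (a + ℓ) ≡ false
      first = proj₁ (starts0ends1-backward p (admissible-step adm e) target)
    ...     | no a+ℓ≢ = ⊥-elim (no-cut-across-101 (proj₁ (proj₂ adm)) (admissible-cut adm 1≤ℓ ℓ≤ eq) sync zeros M+2≤Z 010≤M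
                (λ q 1≤q q<J → no11 q 1≤q (≤-trans q<J J≤A))
                (proj₁ adm) (≤-pred (≤∧≢⇒< a≤ a≢)) (≤∧≢⇒< (≰⇒> a+ℓ≰) (a+ℓ≢ ∘ sym))
                (≤-trans Z<B (proj₂ (path-shrinks p))))
    visits {a} {b} (step e@(cutR 1≤ℓ ℓ≤ eq) p) adm a≤ with a ≟ suc J
    ... | yes refl = b , here refl
    ... | no _ = let k , v = visits p (admissible-step adm e) a≤ in k , there v

  module RightSynchroniser
    (A B D : ℕ) (B≤ : B ≤ suc D)
    (target : Starts0Ends1 (A , B))
    (sync : OccursAt p0110 w D)
    (no1001 : ∀ q → 1 ≤ q → OccursAt p1001 w q → ⊥)
    where

    visits : ∀ {a b} (p : Path w (a , b) (A , B)) → Admissible (a , b) → suc D ≤ b →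
      ∃ λ k → (k , suc D) ∈ vertices p
    visits stop _ ≤b = A , here (cong (A ,_) (≤-antisym ≤b B≤))
    visits {a} {b} (step e@(cutL 1≤ℓ ℓ≤ eq) p) adm ≤b with b ≟ suc D
    ... | yes refl = a , here refl
    ... | no _ = let k , v = visits p (admissible-step adm e) ≤b in k , there v
    visits {a} {b} (step e@(cutR {ℓ = ℓ} 1≤ℓ ℓ≤ eq) p) adm ≤b with b ≟ suc D
    ... | yes refl = a , here refl
    ... | no b≢ with suc D ≤? b ∸ ℓ
    ...   | yes ≤b∸ℓ = let k , v = visits p (admissible-step adm e) ≤b∸ℓ in k , there v
    ...   | no ≰b∸ℓ with b ∸ ℓ ≟ D
    ...     | yes b∸ℓ≡ = contradiction (trans (sym (proj₁ sync)) (subst (λ n → w ‼ n ≡ true) b∸ℓ≡ last)) λ ()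
      where
      last : w ‼ (b ∸ ℓ) ≡ true
      last = proj₂ (starts0ends1-backward p (admissible-step adm e) target)
    ...     | no b∸ℓ≢ = ⊥-elim (no-cut-before-0110 adm c sync no1001 (≤∧≢⇒< ≤b (b≢ ∘ sym)) b<D+ℓ)
      where
      c = admissible-cut adm 1≤ℓ ℓ≤ eq
      b<D+ℓ : b < D + ℓ
      b<D+ℓ = subst (_≤ D + ℓ) (cong suc (m∸n+n≡m (Cut.ℓ≤b c))) (+-monoˡ-≤ ℓ (≤∧≢⇒< (≤-pred (≰⇒> ≰b∸ℓ)) b∸ℓ≢))

-- Pattern avoidance

startsWith : Word → Word → Bool
startsWith []      _       = true
startsWith (_ ∷ _) []      = false
startsWith (p ∷ P) (c ∷ w) = not (p xor c) ∧ startsWith P w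

avoids : Word → Word → Bool
avoids P []      = true
avoids P (c ∷ w) = not (startsWith P (c ∷ w)) ∧ avoids P w

occurs⇒startsWith : ∀ P w → OccursAt P w 1 → length P ≤ length w → startsWith P w ≡ true
occurs⇒startsWith []      w       _           _         = refl
occurs⇒startsWith (p ∷ P) (c ∷ w) (refl , occ) (s≤s fits)
  rewrite xor-same c = occurs⇒startsWith P w (occurs-++ʳ⁻ P (c ∷ []) w 0 occ) fits

avoids-sound : ∀ P w s → avoids P w ≡ true → OccursAt P w (suc s) → s + length P ≤ length w → 1 ≤ length P → ⊥
avoids-sound P []      s _ _ fits nonempty with () ← ≤-trans nonempty (≤-trans (m≤n+m (length P) s) fits)
avoids-sound P (c ∷ w) zero av occ fits _ rewrite occurs⇒startsWith P (c ∷ w) occ fits with () ← av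
avoids-sound P (c ∷ w) (suc s) av occ (s≤s fits) nonempty =
  avoids-sound P w s (∧-snd (not (startsWith P (c ∷ w))) av) (occurs-++ʳ⁻ P (c ∷ []) w s occ) fits nonempty
  where
  ∧-snd : ∀ x {y} → x ∧ y ≡ true → y ≡ true
  ∧-snd true e = e

-- B-absorbs holds by evaluation with v abstract: every window of length |P| starting inside B α ends inside B α ++ h.
module BlockAvoidance (P : Word) (B : Fin 3 → Word) (h : Word)
  (B-starts : ∀ α v → ∃ λ v′ → B α ++ v ≡ h ++ v′)
  (B-absorbs : ∀ α v → avoids P (B α ++ h ++ v) ≡ avoids P (h ++ v))
  (B-avoids : ∀ α → avoids P (B α) ≡ true)
  where

  blocks : List (Fin 3) → Word
  blocks U = concat (map B U)

  blocks-starts : ∀ U v → ∃ λ v′ → blocks U ++ h ++ v ≡ h ++ v′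
  blocks-starts []      v = v , refl
  blocks-starts (α ∷ U) v with v′ , e ← B-starts α (blocks U ++ h ++ v) = v′ , trans (++-assoc (B α) (blocks U) (h ++ v)) e

  blocks-absorb : ∀ U v → avoids P (blocks U ++ h ++ v) ≡ avoids P (h ++ v)
  blocks-absorb []      v = refl
  blocks-absorb (α ∷ U) v with v′ , e ← blocks-starts U v = begin
    avoids P ((B α ++ blocks U) ++ h ++ v) ≡⟨ cong (avoids P) (++-assoc (B α) (blocks U) (h ++ v)) ⟩
    avoids P (B α ++ blocks U ++ h ++ v)   ≡⟨ cong (λ u → avoids P (B α ++ u)) e ⟩
    avoids P (B α ++ h ++ v′)              ≡⟨ B-absorbs α v′ ⟩
    avoids P (h ++ v′)                     ≡⟨ cong (avoids P) (sym e) ⟩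
    avoids P (blocks U ++ h ++ v)          ≡⟨ blocks-absorb U v ⟩
    avoids P (h ++ v)                      ∎
    where open ≡-Reasoning

  ++-blocks-avoid : ∀ u → (∀ v → avoids P (u ++ h ++ v) ≡ avoids P (h ++ v)) → avoids P u ≡ true →
    ∀ U → avoids P (blocks U) ≡ true → avoids P (u ++ blocks U) ≡ true
  ++-blocks-avoid u _   u-avoids []      _ = trans (cong (avoids P) (++-identityʳ u)) u-avoids
  ++-blocks-avoid u abs _        (β ∷ U) U-avoids with v′ , e ← B-starts β (blocks U) = begin
    avoids P (u ++ B β ++ blocks U) ≡⟨ cong (λ z → avoids P (u ++ z)) e ⟩
    avoids P (u ++ h ++ v′)         ≡⟨ abs v′ ⟩
    avoids P (h ++ v′)              ≡⟨ cong (avoids P) (sym e) ⟩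
    avoids P (B β ++ blocks U)      ≡⟨ U-avoids ⟩
    true                            ∎
    where open ≡-Reasoning

  blocks-avoid : ∀ U → avoids P (blocks U) ≡ true
  blocks-avoid []      = refl
  blocks-avoid (α ∷ U) = ++-blocks-avoid (B α) (B-absorbs α) (B-avoids α) U (blocks-avoid U)

occurs-in-++-avoiding : ∀ P u v q → avoids P v ≡ true → 1 ≤ length P →
  q + length P ≤ suc (length u + length v) → OccursAt P (u ++ v) q → q ≤ length u
occurs-in-++-avoiding P u v q av nonempty fits occ with q ≤? length u
... | yes q≤ = q≤
... | no q≰ with r , refl ← m≤n⇒∃[o]m+o≡n (≰⇒> q≰) =
  ⊥-elim (avoids-sound P v r av (occurs-++ʳ⁻ P u v r occ) fits′ nonempty)
  where
  fits′ : r + length P ≤ length v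
  fits′ = +-cancelˡ-≤ (length u) (r + length P) (length v)
            (subst (_≤ length u + length v) (+-assoc (length u) r (length P)) (≤-pred fits))

-- The gadgets

p01 : Word
p01 = o ∷ i ∷ []

EL-starts : ∀ α v → ∃ λ v′ → EL α ++ v ≡ p01 ++ v′
EL-starts α v = _ , refl

ER-starts : ∀ γ v → ∃ λ v′ → ER γ ++ v ≡ p101 ++ v′
ER-starts γ v = _ , refl

ER-ends : ∀ γ → ∃ λ u → ER γ ≡ u ++ p01
ER-ends γ = take (length (ER γ) ∸ 2) (ER γ) , ER-ends′ γ
  where
  ER-ends′ : ∀ γ → ER γ ≡ take (length (ER γ) ∸ 2) (ER γ) ++ p01
  ER-ends′ zero             = refl
  ER-ends′ (suc zero)       = refl
  ER-ends′ (suc (suc zero)) = refl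

EL-absorbs-11 : ∀ α v → avoids p11 (EL α ++ p01 ++ v) ≡ avoids p11 (p01 ++ v)
EL-absorbs-11 zero             v = refl
EL-absorbs-11 (suc zero)       v = refl
EL-absorbs-11 (suc (suc zero)) v = refl

EL-avoids-11 : ∀ α → avoids p11 (EL α) ≡ true
EL-avoids-11 zero             = refl
EL-avoids-11 (suc zero)       = refl
EL-avoids-11 (suc (suc zero)) = refl

EL-absorbs-1001 : ∀ α v → avoids p1001 (EL α ++ p01 ++ v) ≡ avoids p1001 (p01 ++ v)
EL-absorbs-1001 zero             v = refl
EL-absorbs-1001 (suc zero)       v = refl
EL-absorbs-1001 (suc (suc zero)) v = refl

EL-avoids-1001 : ∀ α → avoids p1001 (EL α) ≡ true
EL-avoids-1001 zero             = refl
EL-avoids-1001 (suc zero)       = refl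
EL-avoids-1001 (suc (suc zero)) = refl

ER-absorbs-010 : ∀ γ v → avoids p010 (ER γ ++ p101 ++ v) ≡ avoids p010 (p101 ++ v)
ER-absorbs-010 zero             v = refl
ER-absorbs-010 (suc zero)       v = refl
ER-absorbs-010 (suc (suc zero)) v = refl

ER-avoids-010 : ∀ γ → avoids p010 (ER γ) ≡ true
ER-avoids-010 zero             = refl
ER-avoids-010 (suc zero)       = refl
ER-avoids-010 (suc (suc zero)) = refl

ER-absorbs-1001 : ∀ γ v → avoids p1001 (ER γ ++ p101 ++ v) ≡ avoids p1001 (p101 ++ v)
ER-absorbs-1001 zero             v = refl
ER-absorbs-1001 (suc zero)       v = refl
ER-absorbs-1001 (suc (suc zero)) v = refl

ER-avoids-1001 : ∀ γ → avoids p1001 (ER γ) ≡ true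
ER-avoids-1001 zero             = refl
ER-avoids-1001 (suc zero)       = refl
ER-avoids-1001 (suc (suc zero)) = refl

module EL-11   = BlockAvoidance p11   EL p01  EL-starts EL-absorbs-11   EL-avoids-11
module EL-1001 = BlockAvoidance p1001 EL p01  EL-starts EL-absorbs-1001 EL-avoids-1001
module ER-010  = BlockAvoidance p010  ER p101 ER-starts ER-absorbs-010  ER-avoids-010
module ER-1001 = BlockAvoidance p1001 ER p101 ER-starts ER-absorbs-1001 ER-avoids-1001

-- The 1 of each Sync_L is followed by the 01 that begins the next gadget.
EL-sync : ∀ α v k → k ≡ 1585 ⊎ k ≡ 1587 + length (IL α) →
  OccursAt p101 (EL α ++ p01 ++ v) (suc k) × suc k ≤ length (EL α)
EL-sync zero             v _ (inj₁ refl) = (refl , refl , refl , tt) , m≤m+n 1586 277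
EL-sync (suc zero)       v _ (inj₁ refl) = (refl , refl , refl , tt) , m≤m+n 1586 380
EL-sync (suc (suc zero)) v _ (inj₁ refl) = (refl , refl , refl , tt) , m≤m+n 1586 479
EL-sync zero             v _ (inj₂ refl) = (refl , refl , refl , tt) , ≤-refl
EL-sync (suc zero)       v _ (inj₂ refl) = (refl , refl , refl , tt) , ≤-refl
EL-sync (suc (suc zero)) v _ (inj₂ refl) = (refl , refl , refl , tt) , ≤-refl

-- Each Sync_R = 101 is preceded by the 01 that ends the previous gadget.
ER-sync : ∀ γ v k → k ≡ 0 ⊎ k ≡ 3 + length (IR γ) → OccursAt p0110 (p01 ++ ER γ ++ v) (suc k)
ER-sync γ                v _ (inj₁ refl) = refl , refl , refl , refl , tt
ER-sync zero             v _ (inj₂ refl) = refl , refl , refl , refl , tt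
ER-sync (suc zero)       v _ (inj₂ refl) = refl , refl , refl , refl , tt
ER-sync (suc (suc zero)) v _ (inj₂ refl) = refl , refl , refl , refl , tt

-- The synchronizers of x

leftPart-split : ∀ S (ℓ : Fin (length S)) →
  leftPart S ≡ leftPart (take (toℕ ℓ) S) ++ EL (lookup S ℓ) ++ leftPart (drop (suc (toℕ ℓ)) S)
leftPart-split (α ∷ S) zero    = refl
leftPart-split (α ∷ S) (suc ℓ) =
  trans (cong (EL α ++_) (leftPart-split S ℓ)) (sym (++-assoc (EL α) (leftPart (take (toℕ ℓ) S)) _))

rightPart-∷ : ∀ γ T → rightPart (γ ∷ T) ≡ rightPart T ++ ER γ
rightPart-∷ γ T = begin
  concat (map ER (reverse (γ ∷ T)))          ≡⟨ cong (concat ∘ map ER) (unfold-reverse γ T) ⟩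
  concat (map ER (reverse T ++ γ ∷ []))      ≡⟨ cong concat (map-++ ER (reverse T) (γ ∷ [])) ⟩
  concat (map ER (reverse T) ++ ER γ ∷ [])   ≡⟨ sym (concat-++ (map ER (reverse T)) (ER γ ∷ [])) ⟩
  rightPart T ++ ER γ ++ []                  ≡⟨ cong (rightPart T ++_) (++-identityʳ (ER γ)) ⟩
  rightPart T ++ ER γ                        ∎
  where open ≡-Reasoning

rightPart-split : ∀ T (r : Fin (length T)) →
  rightPart T ≡ rightPart (drop (suc (toℕ r)) T) ++ ER (lookup T r) ++ rightPart (take (toℕ r) T)
rightPart-split (γ ∷ T) zero    = trans (rightPart-∷ γ T) (cong (rightPart T ++_) (sym (++-identityʳ (ER γ))))
rightPart-split (γ ∷ T) (suc r) = begin
  rightPart (γ ∷ T)                   ≡⟨ rightPart-∷ γ T ⟩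
  rightPart T ++ ER γ                 ≡⟨ cong (_++ ER γ) (rightPart-split T r) ⟩
  (Rₒ ++ ER δ ++ Rᵢ) ++ ER γ          ≡⟨ ++-assoc Rₒ (ER δ ++ Rᵢ) (ER γ) ⟩
  Rₒ ++ (ER δ ++ Rᵢ) ++ ER γ          ≡⟨ cong (Rₒ ++_) (++-assoc (ER δ) Rᵢ (ER γ)) ⟩
  Rₒ ++ ER δ ++ Rᵢ ++ ER γ            ≡⟨ cong (λ u → Rₒ ++ ER δ ++ u) (sym (rightPart-∷ γ (take (toℕ r) T))) ⟩
  Rₒ ++ ER δ ++ rightPart (γ ∷ take (toℕ r) T) ∎
  where
  open ≡-Reasoning
  Rₒ = rightPart (drop (suc (toℕ r)) T)
  δ  = lookup T r
  Rᵢ = rightPart (take (toℕ r) T)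

++-blocks-ends-with : ∀ (B : Fin 3 → Word) h → (∀ γ → ∃ λ u → B γ ≡ u ++ h) →
  ∀ w → (∃ λ u → w ≡ u ++ h) → ∀ U → ∃ λ u → w ++ concat (map B U) ≡ u ++ h
++-blocks-ends-with B h B-ends w (u , e) []      = u , trans (++-identityʳ w) e
++-blocks-ends-with B h B-ends w _       (γ ∷ U) with u′ , e ← B-ends γ
  with u , e′ ← ++-blocks-ends-with B h B-ends (w ++ B γ) (w ++ u′ , trans (cong (w ++_) e) (sym (++-assoc w u′ h))) U =
  u , trans (sym (++-assoc w (B γ) (concat (map B U)))) e′

leftPart-++-at : ∀ S (ℓ : Fin (length S)) z → (∃ λ v → z ≡ p01 ++ v) → ∃ λ v →
  leftPart S ++ z ≡ leftPart (take (toℕ ℓ) S) ++ EL (lookup S ℓ) ++ p01 ++ v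
leftPart-++-at S ℓ z (v₀ , refl) with v , e ← EL-1001.blocks-starts (drop (suc (toℕ ℓ)) S) v₀ = v , (begin
  leftPart S ++ p01 ++ v₀               ≡⟨ cong (_++ p01 ++ v₀) (leftPart-split S ℓ) ⟩
  (P₀ ++ EL α ++ P₁) ++ p01 ++ v₀       ≡⟨ ++-assoc P₀ (EL α ++ P₁) (p01 ++ v₀) ⟩
  P₀ ++ (EL α ++ P₁) ++ p01 ++ v₀       ≡⟨ cong (P₀ ++_) (++-assoc (EL α) P₁ (p01 ++ v₀)) ⟩
  P₀ ++ EL α ++ P₁ ++ p01 ++ v₀         ≡⟨ cong (λ u → P₀ ++ EL α ++ u) e ⟩
  P₀ ++ EL α ++ p01 ++ v                ∎)
  where
  open ≡-Reasoning
  α  = lookup S ℓ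
  P₀ = leftPart (take (toℕ ℓ) S)
  P₁ = leftPart (drop (suc (toℕ ℓ)) S)

++-rightPart-sync : ∀ z → (∃ λ u → z ≡ u ++ p01) → ∀ T (r : Fin (length T)) k →
  k ≡ 0 ⊎ k ≡ 3 + length (IR (lookup T r)) → ∃ λ u →
  length u + 2 ≡ length z + length (rightPart (drop (suc (toℕ r)) T)) ×
  OccursAt p0110 (z ++ rightPart T) (suc (length u + k))
++-rightPart-sync z z-ends T r k k≡ with u , e ← ++-blocks-ends-with ER p01 ER-ends z z-ends (reverse (drop (suc (toℕ r)) T)) =
  u , |u|+2 , subst (λ w → OccursAt p0110 w (suc (length u + k))) (sym z++R≡)
                (occurs-++ʳ p0110 u (p01 ++ Bₗ) k (ER-sync γ Rᵢ k k≡))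
  where
  open ≡-Reasoning
  γ  = lookup T r
  Rₒ = rightPart (drop (suc (toℕ r)) T)
  Rᵢ = rightPart (take (toℕ r) T)
  Bₗ = ER γ ++ Rᵢ
  z++R≡ : z ++ rightPart T ≡ u ++ p01 ++ Bₗ
  z++R≡ = begin
    z ++ rightPart T    ≡⟨ cong (z ++_) (rightPart-split T r) ⟩
    z ++ Rₒ ++ Bₗ       ≡⟨ sym (++-assoc z Rₒ Bₗ) ⟩
    (z ++ Rₒ) ++ Bₗ     ≡⟨ cong (_++ Bₗ) e ⟩
    (u ++ p01) ++ Bₗ    ≡⟨ ++-assoc u p01 Bₗ ⟩
    u ++ p01 ++ Bₗ      ∎
  |u|+2 : length u + 2 ≡ length z + length Rₒ
  |u|+2 = trans (sym (length-++ u {p01})) (trans (cong length (sym e)) (length-++ z {Rₒ}))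

leftSync-offset : ∀ p m {is} → is ≡ p + 1584 + 1 ⊎ is ≡ p + 1584 + 2 + m + 1 →
  ∃ λ k → (k ≡ 1585 ⊎ k ≡ 1587 + m) × is + 1 ≡ suc (p + k)
leftSync-offset p m (inj₁ refl) = 1585 , inj₁ refl , shuffle p
  where
  shuffle : ∀ p → p + 1584 + 1 + 1 ≡ suc (p + 1585)
  shuffle = solve-∀
leftSync-offset p m (inj₂ refl) = 1587 + m , inj₂ refl , shuffle p m
  where
  shuffle : ∀ p m → p + 1584 + 2 + m + 1 + 1 ≡ suc (p + (1587 + m))
  shuffle = solve-∀

leftSync-occurs : ∀ S T {is js} → LeftSync S is js → OccursAt p101 (xw S T) js × js ≤ length (leftPart S)
leftSync-occurs S T {is} (ℓ , which , refl) =
  subst (λ j → OccursAt p101 (xw S T) j × j ≤ length (leftPart S)) (sym js≡) (occ , bound)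
  where
  α  = lookup S ℓ
  P₀ = leftPart (take (toℕ ℓ) S)
  P₁ = leftPart (drop (suc (toℕ ℓ)) S)
  offset = leftSync-offset (length P₀) (length (IL α)) which
  k   = proj₁ offset
  k≡  = proj₁ (proj₂ offset)
  js≡ = proj₂ (proj₂ offset)
  split = leftPart-++-at S ℓ (yw ++ rightPart T) (drop 2 yw ++ rightPart T , refl)
  v  = proj₁ split
  x≡ = proj₂ split
  sync = EL-sync α v k k≡
  occ : OccursAt p101 (xw S T) (suc (length P₀ + k))
  occ = subst (λ z → OccursAt p101 z (suc (length P₀ + k))) (sym x≡) (occurs-++ʳ p101 P₀ _ k (proj₁ sync))
  bound : suc (length P₀ + k) ≤ length (leftPart S)
  bound = begin
    suc (length P₀ + k)                   ≡⟨ sym (+-suc (length P₀) k) ⟩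
    length P₀ + suc k                     ≤⟨ +-monoʳ-≤ (length P₀) (proj₂ sync) ⟩
    length P₀ + length (EL α)             ≤⟨ +-monoʳ-≤ (length P₀) (m≤m+n (length (EL α)) (length P₁)) ⟩
    length P₀ + (length (EL α) + length P₁) ≡⟨ cong (length P₀ +_) (sym (length-++ (EL α) {P₁})) ⟩
    length P₀ + length (EL α ++ P₁)       ≡⟨ sym (length-++ P₀ {EL α ++ P₁}) ⟩
    length (P₀ ++ EL α ++ P₁)             ≡⟨ cong length (sym (leftPart-split S ℓ)) ⟩
    length (leftPart S)                   ∎
    where open ≤-Reasoning

rightSync-offset : ∀ n m {is} → is ≡ n + 1 ⊎ is ≡ n + 3 + m + 1 →
  ∃ λ k → (k ≡ 0 ⊎ k ≡ 3 + m) × is ∸ 1 ≡ n + k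
rightSync-offset n m (inj₁ refl) = 0 , inj₁ refl , trans (cong (_∸ 1) (+-comm n 1)) (sym (+-identityʳ n))
rightSync-offset n m (inj₂ refl) = 3 + m , inj₂ refl , cong (_∸ 1) (shuffle n m)
  where
  shuffle : ∀ n m → n + 3 + m + 1 ≡ suc (n + (3 + m))
  shuffle = solve-∀

rightSync-occurs : ∀ S T {is js} → RightSync S T is js →
  ∃ λ D → is ∸ 1 ≡ suc D × OccursAt p0110 (xw S T) D × length (leftPart S) + length yw ≤ suc D
rightSync-occurs S T {is} (r , which , _) =
  suc (length L + (length u + k)) , is∸1≡ , occurs-++ʳ p0110 L (yw ++ rightPart T) (length u + k) occ , bound
  where
  L  = leftPart S
  Rₒ = rightPart (drop (suc (toℕ r)) T)
  offset = rightSync-offset (length L + length yw + length Rₒ) (length (IR (lookup T r))) which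
  k   = proj₁ offset
  sync = ++-rightPart-sync yw (take 3179 yw , refl) T r k (proj₁ (proj₂ offset))
  u     = proj₁ sync
  |u|+2 = proj₁ (proj₂ sync)
  occ   = proj₂ (proj₂ sync)
  is∸1≡ : is ∸ 1 ≡ suc (suc (length L + (length u + k)))
  is∸1≡ = begin
    is ∸ 1                                 ≡⟨ proj₂ (proj₂ offset) ⟩
    length L + length yw + length Rₒ + k   ≡⟨ cong (_+ k) (+-assoc (length L) (length yw) (length Rₒ)) ⟩
    length L + (length yw + length Rₒ) + k ≡⟨ cong (λ n → length L + n + k) (sym |u|+2) ⟩
    length L + (length u + 2) + k          ≡⟨ shuffle (length L) (length u) k ⟩
    suc (suc (length L + (length u + k)))  ∎
    where
    open ≡-Reasoning
    shuffle : ∀ a b k → a + (b + 2) + k ≡ suc (suc (a + (b + k)))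
    shuffle = solve-∀
  bound : length L + length yw ≤ suc (suc (length L + (length u + k)))
  bound = begin
    length L + length yw                   ≤⟨ +-monoʳ-≤ (length L) (m≤m+n (length yw) (length Rₒ)) ⟩
    length L + (length yw + length Rₒ)     ≡⟨ cong (length L +_) (sym |u|+2) ⟩
    length L + (length u + 2)              ≤⟨ +-monoʳ-≤ (length L) (+-monoʳ-≤ (length u) (m≤n+m 2 k)) ⟩
    length L + (length u + (k + 2))        ≡⟨ shuffle (length L) (length u) k ⟩
    suc (suc (length L + (length u + k)))  ∎
    where
    open ≤-Reasoning
    shuffle : ∀ a b k → a + (b + (k + 2)) ≡ suc (suc (a + (b + k)))
    shuffle = solve-∀

-- y = P_L 01 01 11 00 01 101 P_R with |P_L| = 1584: in x = L y R its 00 sits at |L| + 1591,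
-- and the last 010 of x starts at |L| + 1585, the 0 of its Sync_L.
module Instance (S T : List (Fin 3)) where

  L = leftPart S
  R = rightPart T
  x = xw S T

  open Paths x public

  admissible-root : Admissible (xVertex S T)
  admissible-root = ≤-refl , ≤-refl , λ _ x₂≡0 _ _ → contradiction (trans (sym x₂≡0) x₂≡1) λ ()
    where
    x₂≡1 : x ‼ 2 ≡ true
    x₂≡1 = cong (λ w → w ‼ 2) (proj₂ (EL-1001.blocks-starts S (drop 2 yw ++ R)))

  y-target : Starts0Ends1 (yVertex S T)
  y-target = trans (cong (at x) (sym (+-identityʳ (length L)))) (at-++ʳ L (yw ++ R) 0)
           , trans (cong (at x ∘ (_∸ 1)) (+-suc (length L) 3180)) (at-++ʳ L (yw ++ R) 3180)

  zeros-in-y : OccursAt p00 x (suc (length L + 1590))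
  zeros-in-y = occurs-++ʳ p00 L (yw ++ R) 1590 (refl , refl , tt)

  010-before-zeros : length L + 1585 + 2 ≤ suc (length L + 1590)
  010-before-zeros = subst₂ _≤_ (sym (+-assoc (length L) 1585 2)) (+-suc (length L) 1590) (+-monoʳ-≤ (length L) (m≤m+n 1587 4))

  zeros-before-end : suc (length L + 1590) < length L + length yw
  zeros-before-end = subst (_≤ length L + 3181) (trans (+-suc (length L) 1591) (cong suc (+-suc (length L) 1590)))
                       (+-monoʳ-≤ (length L) (m≤m+n 1592 1589))

  no-11-in-L : ∀ q → 1 ≤ q → suc q ≤ length L → OccursAt p11 x q → ⊥
  no-11-in-L (suc q) _ q+2≤ occ =
    avoids-sound p11 L q (EL-11.blocks-avoid S) (occurs-++ˡ⁻ p11 L (yw ++ R) q fits occ) fits (s≤s z≤n)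
    where
    fits : q + 2 ≤ length L
    fits = subst (_≤ length L) (+-comm 2 q) q+2≤

  no-010-after-P_L : ∀ q → q + 2 ≤ length x → OccursAt p010 x q → q ≤ length L + 1585
  no-010-after-P_L q q+2≤ occ =
    subst (q ≤_) (length-++ L {take 1585 yw})
      (occurs-in-++-avoiding p010 (L ++ take 1585 yw) (drop 1585 yw ++ R) q avoids-010 (s≤s z≤n) fits
        (subst (λ w → OccursAt p010 w q) x≡ occ))
    where
    x≡ : x ≡ (L ++ take 1585 yw) ++ drop 1585 yw ++ R
    x≡ = sym (++-assoc L (take 1585 yw) (drop 1585 yw ++ R))
    avoids-010 : avoids p010 (drop 1585 yw ++ R) ≡ true
    avoids-010 = ER-010.++-blocks-avoid (drop 1585 yw) (λ _ → refl) refl (reverse T) (ER-010.blocks-avoid (reverse T))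
    fits : q + 3 ≤ suc (length (L ++ take 1585 yw) + length (drop 1585 yw ++ R))
    fits = subst₂ _≤_ (sym (+-suc q 2))
             (cong suc (trans (cong length x≡) (length-++ (L ++ take 1585 yw) {drop 1585 yw ++ R})))
             (s≤s q+2≤)

  no-1001 : ∀ q → 1 ≤ q → OccursAt p1001 x q → ⊥
  no-1001 (suc q) _ occ@(_ , _ , _ , x₄≡1 , _) =
    avoids-sound p1001 x q avoids-1001 occ (subst (_≤ length x) (+-comm 4 q) (at-true⇒< x x₄≡1)) (s≤s z≤n)
    where
    avoids-1001 : avoids p1001 x ≡ true
    avoids-1001 = trans (EL-1001.blocks-absorb S (drop 2 yw ++ R))
      (ER-1001.++-blocks-avoid yw (λ _ → refl) refl (reverse T) (ER-1001.blocks-avoid (reverse T)))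

lemma17 : (S T : List (Fin 3)) → (p : Path (xw S T) (xVertex S T) (yVertex S T)) →
    ((is js : ℕ) → LeftSync S is js → ∃ λ k → Visits p (suc js , k))
    × ((is js : ℕ) → RightSync S T is js → ∃ λ k → Visits p (k , is ∸ 1))
lemma17 S T p = after-left-sync , before-right-sync
  where
  open Instance S T

  after-left-sync : (is js : ℕ) → LeftSync S is js → ∃ λ k → Visits p (suc js , k)
  after-left-sync is js sync =
    LeftSynchroniser.visits (length L) (length L + length yw) js (length L + 1585) (suc (length L + 1590))
      (proj₂ occ) 010-before-zeros zeros-before-end y-target (proj₁ occ) zeros-in-y no-010-after-P_L no-11-in-L
      p admissible-root (s≤s z≤n)
    where occ = leftSync-occurs S T sync

  before-right-sync : (is js : ℕ) → RightSync S T is js → ∃ λ k → Visits p (k , is ∸ 1)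
  before-right-sync is js sync =
    subst (λ n → ∃ λ k → Visits p (k , n)) (sym is∸1≡)
      (RightSynchroniser.visits (suc (length L)) (length L + length yw) D y≤ y-target occ no-1001
        p admissible-root (<⇒≤ (at-true⇒< x (proj₁ (proj₂ (proj₂ occ))))))
    where
    found = rightSync-occurs S T sync
    D     = proj₁ found
    is∸1≡ = proj₁ (proj₂ found)
    occ   = proj₁ (proj₂ (proj₂ found))
    y≤    = proj₂ (proj₂ (proj₂ found))
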